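{- Let $d,n$ be real numbers with $n\neq 0$, let $\lambda_1,\lambda_2,\lambda_3$ be three distinct real numbers, and let $\ell_1,\ell_2$ be arbitrary real numbers. Set $C_1=\frac{1}{(\lambda_2-\lambda_1)(\lambda_3-\lambda_1)}$, $C_2=\frac{1}{(\lambda_3-\lambda_2)(\lambda_1-\lambda_2)}$, $C_3=\frac{1}{(\lambda_1-\lambda_3)(\lambda_2-\lambda_3)}$. For $\{p,q,r\}=\{1,2,3\}$ define $$\Delta_p=C_p\{d^2+d-\ell_2+(\ell_1-d)(\lambda_q+\lambda_r)+\lambda_q\lambda_r\},$$ $$\Delta_{pq}=C_pC_q(\lambda_q-\lambda_p)\Big\{\Big(d+\tfrac{1-n}{n}\lambda_r\Big)\ell_2-\Big(d^2+d+\tfrac{1-n}{n}\lambda_r^2\Big)\ell_1-\tfrac1n\big((d^2+d)\lambda_r-d\lambda_r^2\big)\Big\}.$$ Then for every $\{i,j,k\}=\{1,2,3\}$, $$\frac{\lambda_i\lambda_j}{n}\Delta_i+\frac{\lambda_j\lambda_i}{n}\Delta_j+\frac{\lambda_k(\lambda_i+\lambda_j-\lambda_k)}{n}\Delta_k-(\lambda_k-\lambda_i)(\lambda_k-\lambda_j)(\Delta_{ik}+\Delta_{jk})=\ell_2-\ell_1(\lambda_i+\lambda_j).$$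
   Context: This is a purely algebraic identity; in the graph setting $\ell_1=L(u,v)$, $\ell_2=L^2(u,v)$, $d$ is the degree, $n$ the number of vertices and $\lambda_i$ the nonzero Laplacian eigenvalues, but no such interpretation is required. -}

module Defs where

open import Level using (suc; _⊔_)
open import Algebra.Bundles using (CommutativeRing)
open import Relation.Nullary using (¬_)
open import Data.Fin using (Fin)

-- A field: a commutative ring with 0 ≠ 1 and a (total) inverse operation
-- which is a two-sided inverse on nonzero elements (value at 0 irrelevant).
record Field c ℓ : Set (suc (c ⊔ ℓ)) where
  field
    commutativeRing : CommutativeRing c ℓ
  open CommutativeRing commutativeRing public
  field
    _⁻¹      : Carrier → Carrier
    ⁻¹-cong  : ∀ {x y} → x ≈ y → x ⁻¹ ≈ y ⁻¹
    ⁻¹-inverse : ∀ x → ¬ (x ≈ 0#) → x * (x ⁻¹) ≈ 1#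
    0≉1      : ¬ (0# ≈ 1#)

  infixl 7 _/_
  _/_ : Carrier → Carrier → Carrier
  x / y = x * (y ⁻¹)

module Lemma5Defs {c ℓ} (F : Field c ℓ) where
  open Field F

  sq : Carrier → Carrier
  sq x = x * x

  C : (Fin 3 → Carrier) → Fin 3 → Fin 3 → Fin 3 → Carrier
  C lam p q r = (1# / ((lam q - lam p) * (lam r - lam p)))

  Δ : (d ℓ₁ ℓ₂ : Carrier) → (Fin 3 → Carrier) → Fin 3 → Fin 3 → Fin 3 → Carrier
  Δ d ℓ₁ ℓ₂ lam p q r =
    C lam p q r * (sq d + d - ℓ₂ + (ℓ₁ - d) * (lam q + lam r) + lam q * lam r)

  Δ₂ : (d n ℓ₁ ℓ₂ : Carrier) → (Fin 3 → Carrier) → Fin 3 → Fin 3 → Fin 3 → Carrier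
  Δ₂ d n ℓ₁ ℓ₂ lam p q r =
    C lam p q r * C lam q p r * (lam q - lam p) *
      ( (d + ((1# - n) / n) * lam r) * ℓ₂
      - (sq d + d + ((1# - n) / n) * sq (lam r)) * ℓ₁
      - (1# / n) * ((sq d + d) * lam r - d * sq (lam r)) )

{-# OPTIONS --safe #-}
-- Let V = (λj - λi)(λk - λi)(λk - λj).  For (p, q, r) a cyclic shift of
-- (i, j, k) one has C_p = (λr - λq) / V, so once V is cleared the Δ_p-terms
-- reduce to a polynomial identity of Lagrange-interpolation type with value
-- κ = ℓ₂ - ℓ₁(λi + λj) - (d² + d) + d(λi + λj).  In the Δ_pq-terms the
-- Vandermonde factors cancel down to the divided difference
-- (g(λj) - g(λi)) / (λj - λi) of the quadratic brace g of Δ_pq, which equals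
-- κ / n - (ℓ₂ - ℓ₁(λi + λj)).  The claim is κ / n minus this.
module Submission where

open import Algebra.Bundles using (CommutativeRing)
open import Algebra.Solver.Ring.AlmostCommutativeRing
  using (fromCommutativeRing; _-Raw-AlmostCommutative⟶_; Induced-equivalence)
open import Data.Fin using (Fin)
open import Data.Integer.Base as ℤ using (ℤ; +_; -[1+_]; _⊖_; _◃_; sign; ∣_∣)
open import Data.Integer.Properties using ([1+m]⊖[1+n]≡m⊖n) renaming (_≟_ to _≟ᶻ_)
open import Data.Maybe.Base as Maybe using ()
open import Data.Nat.Base as ℕ using (zero; suc)
open import Data.Nat.Properties using (+-suc)
open import Data.Sign.Base as Sign using (Sign)
open import Relation.Binary.Consequences using (dec⇒weaklyDec)
open import Relation.Binary.Definitions using (WeaklyDecidable)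
open import Relation.Binary.PropositionalEquality as ≡ using (_≡_; ≢-sym)
open import Relation.Nullary using (¬_)

open import Defs

module IntegerCoefficients {c ℓ} (R : CommutativeRing c ℓ) where
  open CommutativeRing R
  open import Algebra.Properties.Ring ring
    using (-0#≈0#; -‿involutive; -‿+-comm; -‿distribˡ-*; -‿distribʳ-*)
  open import Algebra.Properties.Semiring.Mult.TCOptimised semiring
    using (_×_; 1+×; ×-homo-+; ×1-homo-*)
  open import Relation.Binary.Reasoning.Setoid setoid

  -- The type-checking-optimised _×_ makes ⟦ + 1 ⟧ℤ reduce to 1#, so solver
  -- constants con (+ 1) match 1# in goals definitionally.
  ⟦_⟧ℤ : ℤ → Carrier
  ⟦ + n ⟧ℤ      = n × 1#
  ⟦ -[1+ n ] ⟧ℤ = - (suc n × 1#)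

  [k+x]-[k+y]≈x-y : ∀ k x y → (k + x) - (k + y) ≈ x - y
  [k+x]-[k+y]≈x-y k x y = begin
    (k + x) - (k + y)     ≈⟨ +-congˡ (-‿+-comm k y) ⟨
    (k + x) + (- k - y)   ≈⟨ +-assoc k x (- k - y) ⟩
    k + (x + (- k - y))   ≈⟨ +-congˡ (+-congˡ (+-comm (- k) (- y))) ⟩
    k + (x + (- y - k))   ≈⟨ +-congˡ (+-assoc x (- y) (- k)) ⟨
    k + ((x - y) - k)     ≈⟨ +-comm k _ ⟩
    ((x - y) - k) + k     ≈⟨ +-assoc (x - y) (- k) k ⟩
    (x - y) + (- k + k)   ≈⟨ +-congˡ (-‿inverseˡ k) ⟩
    (x - y) + 0#          ≈⟨ +-identityʳ (x - y) ⟩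
    x - y                 ∎

  ⊖-homo : ∀ m n → ⟦ m ⊖ n ⟧ℤ ≈ m × 1# - n × 1#
  ⊖-homo zero    zero    = sym (-‿inverseʳ 0#)
  ⊖-homo (suc m) zero    = sym (trans (+-congˡ -0#≈0#) (+-identityʳ _))
  ⊖-homo zero    (suc n) = sym (+-identityˡ _)
  ⊖-homo (suc m) (suc n) = begin
    ⟦ suc m ⊖ suc n ⟧ℤ              ≡⟨ ≡.cong ⟦_⟧ℤ ([1+m]⊖[1+n]≡m⊖n m n) ⟩
    ⟦ m ⊖ n ⟧ℤ                      ≈⟨ ⊖-homo m n ⟩
    m × 1# - n × 1#                 ≈⟨ [k+x]-[k+y]≈x-y 1# (m × 1#) (n × 1#) ⟨
    (1# + m × 1#) - (1# + n × 1#)   ≈⟨ +-cong (1+× m 1#) (-‿cong (1+× n 1#)) ⟨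
    suc m × 1# - suc n × 1#         ∎

  +-homo : ∀ i j → ⟦ i ℤ.+ j ⟧ℤ ≈ ⟦ i ⟧ℤ + ⟦ j ⟧ℤ
  +-homo -[1+ m ] -[1+ n ] = begin
    - (suc (suc (m ℕ.+ n)) × 1#)      ≡⟨ ≡.cong (λ k → - (suc k × 1#)) (+-suc m n) ⟨
    - ((suc m ℕ.+ suc n) × 1#)        ≈⟨ -‿cong (×-homo-+ 1# (suc m) (suc n)) ⟩
    - (suc m × 1# + suc n × 1#)       ≈⟨ -‿+-comm _ _ ⟨
    - (suc m × 1#) + - (suc n × 1#)   ∎
  +-homo -[1+ m ] (+ n)    = trans (⊖-homo n (suc m)) (+-comm _ _)
  +-homo (+ m)    -[1+ n ] = ⊖-homo m (suc n)
  +-homo (+ m)    (+ n)    = ×-homo-+ 1# m n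

  signed : Sign → Carrier → Carrier
  signed Sign.+ x = x
  signed Sign.- x = - x

  signed-cong : ∀ s {x y} → x ≈ y → signed s x ≈ signed s y
  signed-cong Sign.+ x≈y = x≈y
  signed-cong Sign.- x≈y = -‿cong x≈y

  signed-* : ∀ s t x y → signed (s Sign.* t) (x * y) ≈ signed s x * signed t y
  signed-* Sign.+ Sign.+ x y = refl
  signed-* Sign.+ Sign.- x y = -‿distribʳ-* x y
  signed-* Sign.- Sign.+ x y = -‿distribˡ-* x y
  signed-* Sign.- Sign.- x y = begin
    x * y          ≈⟨ -‿involutive (x * y) ⟨
    - - (x * y)    ≈⟨ -‿cong (-‿distribʳ-* x y) ⟩
    - (x * - y)    ≈⟨ -‿distribˡ-* x (- y) ⟩
    - x * - y      ∎

  ◃-homo : ∀ s n → ⟦ s ◃ n ⟧ℤ ≈ signed s (n × 1#)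
  ◃-homo Sign.+ zero    = refl
  ◃-homo Sign.- zero    = sym -0#≈0#
  ◃-homo Sign.+ (suc n) = refl
  ◃-homo Sign.- (suc n) = refl

  ⟦i⟧ℤ≈signed : ∀ i → ⟦ i ⟧ℤ ≈ signed (sign i) (∣ i ∣ × 1#)
  ⟦i⟧ℤ≈signed (+ n)    = refl
  ⟦i⟧ℤ≈signed -[1+ n ] = refl

  *-homo : ∀ i j → ⟦ i ℤ.* j ⟧ℤ ≈ ⟦ i ⟧ℤ * ⟦ j ⟧ℤ
  *-homo i j = begin
    ⟦ i ℤ.* j ⟧ℤ
      ≈⟨ ◃-homo (sign i Sign.* sign j) (∣ i ∣ ℕ.* ∣ j ∣) ⟩
    signed (sign i Sign.* sign j) ((∣ i ∣ ℕ.* ∣ j ∣) × 1#)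
      ≈⟨ signed-cong (sign i Sign.* sign j) (×1-homo-* ∣ i ∣ ∣ j ∣) ⟩
    signed (sign i Sign.* sign j) ((∣ i ∣ × 1#) * (∣ j ∣ × 1#))
      ≈⟨ signed-* (sign i) (sign j) _ _ ⟩
    signed (sign i) (∣ i ∣ × 1#) * signed (sign j) (∣ j ∣ × 1#)
      ≈⟨ *-cong (⟦i⟧ℤ≈signed i) (⟦i⟧ℤ≈signed j) ⟨
    ⟦ i ⟧ℤ * ⟦ j ⟧ℤ
      ∎

  -‿homo : ∀ i → ⟦ ℤ.- i ⟧ℤ ≈ - ⟦ i ⟧ℤ
  -‿homo (+ zero)  = sym -0#≈0#
  -‿homo (+ suc n) = refl
  -‿homo -[1+ n ]  = sym (-‿involutive _)

  ℤ⟶R : ℤ.+-*-rawRing -Raw-AlmostCommutative⟶ fromCommutativeRing R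
  ℤ⟶R = record
    { ⟦_⟧    = ⟦_⟧ℤ
    ; +-homo = +-homo
    ; *-homo = *-homo
    ; -‿homo = -‿homo
    ; 0-homo = refl
    ; 1-homo = refl
    }

  _≟ℤ_ : WeaklyDecidable (Induced-equivalence ℤ⟶R)
  i ≟ℤ j = Maybe.map (λ { ≡.refl → refl }) (dec⇒weaklyDec _≟ᶻ_ i j)

  open import Algebra.Solver.Ring ℤ.+-*-rawRing (fromCommutativeRing R) ℤ⟶R _≟ℤ_ public
    using (solve; _:=_; _:+_; _:*_; _:-_; con)

module FieldProperties {c ℓ} (F : Field c ℓ) where
  open Field F
  open import Algebra.Properties.Ring ring using (x∙y⁻¹≈ε⇒x≈y)
  open import Relation.Binary.Reasoning.Setoid setoid

  x*y≈1⇒x⁻¹≈y : ∀ {x y} → x * y ≈ 1# → x ⁻¹ ≈ y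
  x*y≈1⇒x⁻¹≈y {x} {y} xy≈1 = begin
    x ⁻¹              ≈⟨ *-identityʳ (x ⁻¹) ⟨
    x ⁻¹ * 1#         ≈⟨ *-congˡ xy≈1 ⟨
    x ⁻¹ * (x * y)    ≈⟨ *-assoc (x ⁻¹) x y ⟨
    x ⁻¹ * x * y      ≈⟨ *-congʳ (*-comm (x ⁻¹) x) ⟩
    x * x ⁻¹ * y      ≈⟨ *-congʳ (⁻¹-inverse x x≉0) ⟩
    1# * y            ≈⟨ *-identityˡ y ⟩
    y                 ∎
    where
    x≉0 : ¬ (x ≈ 0#)
    x≉0 x≈0 = 0≉1 (trans (sym (zeroˡ y)) (trans (*-congʳ (sym x≈0)) xy≈1))

  x*y≈1⇒1/x≈y : ∀ {x y} → x * y ≈ 1# → 1# / x ≈ y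
  x*y≈1⇒1/x≈y xy≈1 = trans (*-identityˡ _) (x*y≈1⇒x⁻¹≈y xy≈1)

  x≉0⇒y≉0⇒x*y≉0 : ∀ {x y} → ¬ (x ≈ 0#) → ¬ (y ≈ 0#) → ¬ (x * y ≈ 0#)
  x≉0⇒y≉0⇒x*y≉0 {x} {y} x≉0 y≉0 xy≈0 = y≉0 (begin
    y                 ≈⟨ *-identityˡ y ⟨
    1# * y            ≈⟨ *-congʳ (⁻¹-inverse x x≉0) ⟨
    x * x ⁻¹ * y      ≈⟨ *-congʳ (*-comm x (x ⁻¹)) ⟩
    x ⁻¹ * x * y      ≈⟨ *-assoc (x ⁻¹) x y ⟩
    x ⁻¹ * (x * y)    ≈⟨ *-congˡ xy≈0 ⟩
    x ⁻¹ * 0#         ≈⟨ zeroʳ (x ⁻¹) ⟩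
    0#                ∎)

  x≉y⇒x-y≉0 : ∀ {x y} → ¬ (x ≈ y) → ¬ (x - y ≈ 0#)
  x≉y⇒x-y≉0 x≉y x-y≈0 = x≉y (x∙y⁻¹≈ε⇒x≈y _ _ x-y≈0)

module Identities {c ℓ} (R : CommutativeRing c ℓ) where
  open CommutativeRing R
  open IntegerCoefficients R
  open import Relation.Binary.Reasoning.Setoid setoid

  vandermonde : Carrier → Carrier → Carrier → Carrier
  vandermonde x y z = (y - x) * (z - x) * (z - y)

  module Brace (d ℓ₁ ℓ₂ : Carrier) where

    δ : Carrier → Carrier → Carrier
    δ s t = d * d + d - ℓ₂ + (ℓ₁ - d) * (s + t) + s * t

    κ : Carrier → Carrier → Carrier
    κ x y = ℓ₂ - ℓ₁ * (x + y) - (d * d + d) + d * (x + y)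

    lagrange-identity : ∀ x y z →
      x * y * ((z - y) * δ y z) + y * x * ((x - z) * δ x z)
        + z * (x + y - z) * ((y - x) * δ x y)
      ≈ κ x y * vandermonde x y z
    lagrange-identity x y z = solve 6 (λ x y z d ℓ₁ ℓ₂ →
        x :* y :* ((z :- y) :* (d :* d :+ d :- ℓ₂ :+ (ℓ₁ :- d) :* (y :+ z) :+ y :* z))
        :+ y :* x :* ((x :- z) :* (d :* d :+ d :- ℓ₂ :+ (ℓ₁ :- d) :* (x :+ z) :+ x :* z))
        :+ z :* (x :+ y :- z) :* ((y :- x) :* (d :* d :+ d :- ℓ₂ :+ (ℓ₁ :- d) :* (x :+ y) :+ x :* y))
      := (ℓ₂ :- ℓ₁ :* (x :+ y) :- (d :* d :+ d) :+ d :* (x :+ y))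
         :* ((y :- x) :* (z :- x) :* (z :- y)))
      refl x y z d ℓ₁ ℓ₂

    -- u stands for 1/n, kept as a variable so that δ₂ is a polynomial.
    module _ (n u : Carrier) where

      δ₂ : Carrier → Carrier
      δ₂ r = (d + ((1# - n) * u) * r) * ℓ₂ - (d * d + d + ((1# - n) * u) * (r * r)) * ℓ₁
             - (1# * u) * ((d * d + d) * r - d * (r * r))

      δ₂-divided-difference : n * u ≈ 1# → ∀ x y →
        δ₂ y - δ₂ x ≈ (y - x) * (u * κ x y - (ℓ₂ - ℓ₁ * (x + y)))
      δ₂-divided-difference nu≈1 x y = begin
        δ₂ y - δ₂ x
          ≈⟨ solve 7 (λ x y d ℓ₁ ℓ₂ n u →
               (d :+ ((con (+ 1) :- n) :* u) :* y) :* ℓ₂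
                 :- (d :* d :+ d :+ ((con (+ 1) :- n) :* u) :* (y :* y)) :* ℓ₁
                 :- (con (+ 1) :* u) :* ((d :* d :+ d) :* y :- d :* (y :* y))
               :- ((d :+ ((con (+ 1) :- n) :* u) :* x) :* ℓ₂
                 :- (d :* d :+ d :+ ((con (+ 1) :- n) :* u) :* (x :* x)) :* ℓ₁
                 :- (con (+ 1) :* u) :* ((d :* d :+ d) :* x :- d :* (x :* x)))
             := (y :- x) :* (u :* (ℓ₂ :- ℓ₁ :* (x :+ y) :- (d :* d :+ d) :+ d :* (x :+ y))
                             :- n :* u :* (ℓ₂ :- ℓ₁ :* (x :+ y))))
             refl x y d ℓ₁ ℓ₂ n u ⟩
        (y - x) * (u * κ x y - n * u * (ℓ₂ - ℓ₁ * (x + y)))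
          ≈⟨ *-congˡ (+-congˡ (-‿cong (trans (*-congʳ nu≈1) (*-identityˡ _)))) ⟩
        (y - x) * (u * κ x y - (ℓ₂ - ℓ₁ * (x + y)))
          ∎

module Interpolation {c ℓ} (F : Field c ℓ) where
  open Field F
  open Lemma5Defs F
  open FieldProperties F
  open IntegerCoefficients commutativeRing
  open Identities commutativeRing
  open import Relation.Binary.Reasoning.Setoid setoid

  module Triple
    (d n ℓ₁ ℓ₂ : Carrier) (lam : Fin 3 → Carrier) (i j k : Fin 3)
    (n*n⁻¹≈1 : n * n ⁻¹ ≈ 1#)
    (w : Carrier) (V*w≈1 : vandermonde (lam i) (lam j) (lam k) * w ≈ 1#) where

    open Brace d ℓ₁ ℓ₂

    x y z : Carrier
    x = lam i
    y = lam j
    z = lam k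

    Δᵢ Δⱼ Δₖ Δᵢₖ Δⱼₖ : Carrier
    Δᵢ  = Δ d ℓ₁ ℓ₂ lam i j k
    Δⱼ  = Δ d ℓ₁ ℓ₂ lam j i k
    Δₖ  = Δ d ℓ₁ ℓ₂ lam k i j
    Δᵢₖ = Δ₂ d n ℓ₁ ℓ₂ lam i k j
    Δⱼₖ = Δ₂ d n ℓ₁ ℓ₂ lam j k i

    C≈ : ∀ {p q r} a → (lam q - lam p) * (lam r - lam p) * a ≈ vandermonde x y z →
         C lam p q r ≈ a * w
    C≈ a eq = x*y≈1⇒1/x≈y (trans (sym (*-assoc _ a w)) (trans (*-congʳ eq) V*w≈1))

    C-comm : ∀ p q r → C lam p q r ≈ C lam p r q
    C-comm p q r = *-congˡ (⁻¹-cong (*-comm _ _))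

    Cᵢ≈ : C lam i j k ≈ (z - y) * w
    Cᵢ≈ = C≈ (z - y) refl

    Cⱼ≈ : C lam j i k ≈ (x - z) * w
    Cⱼ≈ = C≈ (x - z) (solve 3 (λ x y z →
      (x :- y) :* (z :- y) :* (x :- z) := (y :- x) :* (z :- x) :* (z :- y)) refl x y z)

    Cₖ≈ : C lam k i j ≈ (y - x) * w
    Cₖ≈ = C≈ (y - x) (solve 3 (λ x y z →
      (x :- z) :* (y :- z) :* (y :- x) := (y :- x) :* (z :- x) :* (z :- y)) refl x y z)

    weighted-Δ-sum : x * y * Δᵢ + y * x * Δⱼ + z * (x + y - z) * Δₖ ≈ κ x y
    weighted-Δ-sum = begin
      x * y * Δᵢ + y * x * Δⱼ + z * (x + y - z) * Δₖ
        ≈⟨ +-cong (+-cong (*-congˡ (*-congʳ Cᵢ≈)) (*-congˡ (*-congʳ Cⱼ≈)))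
                  (*-congˡ (*-congʳ Cₖ≈)) ⟩
      x * y * ((z - y) * w * δ y z) + y * x * ((x - z) * w * δ x z)
        + z * (x + y - z) * ((y - x) * w * δ x y)
        ≈⟨ solve 7 (λ x y z w P Q S →
             x :* y :* ((z :- y) :* w :* P) :+ y :* x :* ((x :- z) :* w :* Q)
               :+ z :* (x :+ y :- z) :* ((y :- x) :* w :* S)
             := (x :* y :* ((z :- y) :* P) :+ y :* x :* ((x :- z) :* Q)
                  :+ z :* (x :+ y :- z) :* ((y :- x) :* S)) :* w)
           refl x y z w (δ y z) (δ x z) (δ x y) ⟩
      (x * y * ((z - y) * δ y z) + y * x * ((x - z) * δ x z)
        + z * (x + y - z) * ((y - x) * δ x y)) * w
        ≈⟨ *-congʳ (lagrange-identity x y z) ⟩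
      κ x y * vandermonde x y z * w
        ≈⟨ *-assoc _ _ w ⟩
      κ x y * (vandermonde x y z * w)
        ≈⟨ *-congˡ V*w≈1 ⟩
      κ x y * 1#
        ≈⟨ *-identityʳ _ ⟩
      κ x y
        ∎

    weighted-Δ₂-sum-as-difference :
      (z - x) * (z - y) * (Δᵢₖ + Δⱼₖ)
        ≈ vandermonde x y z * w * (w * ((z - x) * (z - y)))
          * (δ₂ n (n ⁻¹) y - δ₂ n (n ⁻¹) x)
    weighted-Δ₂-sum-as-difference = begin
      (z - x) * (z - y) * (Δᵢₖ + Δⱼₖ)
        ≈⟨ *-congˡ (+-cong (*-congʳ (*-congʳ (*-cong (trans (C-comm i k j) Cᵢ≈) Cₖ≈)))
                           (*-congʳ (*-congʳ (*-cong (trans (C-comm j k i) Cⱼ≈)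
                                                     (trans (C-comm k j i) Cₖ≈))))) ⟩
      (z - x) * (z - y) * ((z - y) * w * ((y - x) * w) * (z - x) * δ₂ n (n ⁻¹) y
                           + (x - z) * w * ((y - x) * w) * (z - y) * δ₂ n (n ⁻¹) x)
        ≈⟨ solve 6 (λ x y z w P Q →
             (z :- x) :* (z :- y) :* ((z :- y) :* w :* ((y :- x) :* w) :* (z :- x) :* P
                                      :+ (x :- z) :* w :* ((y :- x) :* w) :* (z :- y) :* Q)
             := (y :- x) :* (z :- x) :* (z :- y) :* w :* (w :* ((z :- x) :* (z :- y)))
                :* (P :- Q))
           refl x y z w (δ₂ n (n ⁻¹) y) (δ₂ n (n ⁻¹) x) ⟩
      vandermonde x y z * w * (w * ((z - x) * (z - y))) * (δ₂ n (n ⁻¹) y - δ₂ n (n ⁻¹) x)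
        ∎

    weighted-Δ₂-sum : (z - x) * (z - y) * (Δᵢₖ + Δⱼₖ) ≈ n ⁻¹ * κ x y - (ℓ₂ - ℓ₁ * (x + y))
    weighted-Δ₂-sum = begin
      (z - x) * (z - y) * (Δᵢₖ + Δⱼₖ)
        ≈⟨ weighted-Δ₂-sum-as-difference ⟩
      vandermonde x y z * w * (w * ((z - x) * (z - y))) * (δ₂ n (n ⁻¹) y - δ₂ n (n ⁻¹) x)
        ≈⟨ *-congˡ (δ₂-divided-difference n (n ⁻¹) n*n⁻¹≈1 x y) ⟩
      vandermonde x y z * w * (w * ((z - x) * (z - y))) * ((y - x) * m)
        ≈⟨ solve 5 (λ x y z w m →
             (y :- x) :* (z :- x) :* (z :- y) :* w :* (w :* ((z :- x) :* (z :- y)))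
               :* ((y :- x) :* m)
             := (y :- x) :* (z :- x) :* (z :- y) :* w
                :* ((y :- x) :* (z :- x) :* (z :- y) :* w) :* m)
           refl x y z w m ⟩
      vandermonde x y z * w * (vandermonde x y z * w) * m
        ≈⟨ *-congʳ (*-cong V*w≈1 V*w≈1) ⟩
      1# * 1# * m
        ≈⟨ trans (*-congʳ (*-identityˡ 1#)) (*-identityˡ m) ⟩
      m
        ∎
      where
      m : Carrier
      m = n ⁻¹ * κ x y - (ℓ₂ - ℓ₁ * (x + y))

lemma5 : ∀ {c ℓ} (F : Field c ℓ) → 
    let open Field F
        open Lemma5Defs F
    in
    (d n ℓ₁ ℓ₂ : Carrier) (lam : Fin 3 → Carrier) →
    ¬ (n ≈ 0#) →
    (∀ a b → ¬ (a ≡ b) → ¬ (lam a ≈ lam b)) →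
    (i j k : Fin 3) → ¬ (i ≡ j) → ¬ (j ≡ k) → ¬ (i ≡ k) →
    ((lam i * lam j) / n) * Δ d ℓ₁ ℓ₂ lam i j k
      + ((lam j * lam i) / n) * Δ d ℓ₁ ℓ₂ lam j i k
      + ((lam k * (lam i + lam j - lam k)) / n) * Δ d ℓ₁ ℓ₂ lam k i j
      - (lam k - lam i) * (lam k - lam j)
        * (Δ₂ d n ℓ₁ ℓ₂ lam i k j + Δ₂ d n ℓ₁ ℓ₂ lam j k i)
      ≈ ℓ₂ - ℓ₁ * (lam i + lam j)
lemma5 F d n ℓ₁ ℓ₂ lam n≉0 lam-injective i j k i≢j j≢k i≢k = begin
    (x * y / n) * Δᵢ + (y * x / n) * Δⱼ + (z * (x + y - z) / n) * Δₖ
      - (z - x) * (z - y) * (Δᵢₖ + Δⱼₖ)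
      ≈⟨ solve 8 (λ x y z u P Q S E →
           x :* y :* u :* P :+ y :* x :* u :* Q :+ z :* (x :+ y :- z) :* u :* S :- E
           := u :* (x :* y :* P :+ y :* x :* Q :+ z :* (x :+ y :- z) :* S) :- E)
         refl x y z (n ⁻¹) Δᵢ Δⱼ Δₖ ((z - x) * (z - y) * (Δᵢₖ + Δⱼₖ)) ⟩
    n ⁻¹ * (x * y * Δᵢ + y * x * Δⱼ + z * (x + y - z) * Δₖ)
      - (z - x) * (z - y) * (Δᵢₖ + Δⱼₖ)
      ≈⟨ +-cong (*-congˡ weighted-Δ-sum) (-‿cong weighted-Δ₂-sum) ⟩
    n ⁻¹ * κ x y - (n ⁻¹ * κ x y - (ℓ₂ - ℓ₁ * (x + y)))
      ≈⟨ solve 2 (λ a b → a :- (a :- b) := b) refl (n ⁻¹ * κ x y) (ℓ₂ - ℓ₁ * (x + y)) ⟩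
    ℓ₂ - ℓ₁ * (x + y)
      ∎
  where
  open Field F
  open FieldProperties F
  open IntegerCoefficients commutativeRing
  open Identities commutativeRing using (vandermonde; module Brace)
  open Brace d ℓ₁ ℓ₂ using (κ)
  open import Relation.Binary.Reasoning.Setoid setoid

  V : Carrier
  V = vandermonde (lam i) (lam j) (lam k)

  lam[a]-lam[b]≉0 : ∀ {a b} → ¬ (a ≡ b) → ¬ (lam a - lam b ≈ 0#)
  lam[a]-lam[b]≉0 a≢b = x≉y⇒x-y≉0 (lam-injective _ _ a≢b)

  V≉0 : ¬ (V ≈ 0#)
  V≉0 = x≉0⇒y≉0⇒x*y≉0
    (x≉0⇒y≉0⇒x*y≉0 (lam[a]-lam[b]≉0 (≢-sym i≢j)) (lam[a]-lam[b]≉0 (≢-sym i≢k)))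
    (lam[a]-lam[b]≉0 (≢-sym j≢k))

  n*n⁻¹≈1 : n * n ⁻¹ ≈ 1#
  n*n⁻¹≈1 = ⁻¹-inverse n n≉0

  V*V⁻¹≈1 : V * V ⁻¹ ≈ 1#
  V*V⁻¹≈1 = ⁻¹-inverse V V≉0

  open Interpolation.Triple F d n ℓ₁ ℓ₂ lam i j k n*n⁻¹≈1 (V ⁻¹) V*V⁻¹≈1
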